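{- Let $m\ge1$, let $C$ be a cycle in $G_m$ containing the vertex $v$, and let $Q=L_{i,x}$ be a leaf block having a vertex on $C$. Say that a chord of $C$ is counted in $Q$ if either both of its endpoints lie in $V(Q)$, or one endpoint is $v$ and the other lies in $V(Q)$. Then at most $4$ chords of $C$ are counted in $Q$.
   Context: Fix $m\ge1$. Spine blocks $S_0,\dots,S_m$: each $S_i$ is a $5$-cycle with vertices $S_i[a],S_i[b],S_i[c],S_i[d],S_i[e]$ in this cyclic order. Leaf blocks: $L_{0,x}$ for $x\in\{a,b,d,e\}$; $L_{i,x}$ for $1\le i\le m-1$ and $x\in\{b,d,e\}$; $L_{m,x}$ for $x\in\{b,c,d,e\}$. Each $L_{i,x}$ is a $5$-cycle with vertices $L_{i,x}[A],\dots,L_{i,x}[E]$ in this cyclic order. All blocks are vertex-disjoint. For a lowercase letter $x$, $X$ denotes the corresponding uppercase letter. Add edges $S_i[x]L_{i,x}[X]$ for each leaf block $L_{i,x}$, and edges $S_i[c]S_{i+1}[a]$ for $0\le i<m$. Finally add a new vertex $v$ adjacent to the four vertices $L_{i,x}[Y]$, $Y\ne X$, of every leaf block $L_{i,x}$. The resulting graph is $G_m$. A chord of a cycle $C$ is an edge of $G_m$ joining two vertices of $C$ that are not consecutive on $C$. -}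

module Defs where

open import Data.Nat using (ℕ; zero; suc; _≡ᵇ_; _≤_)
open import Data.Bool using (Bool; true; false; T; not; _∨_; if_then_else_)
open import Data.Fin using (Fin; zero; suc; toℕ)
open import Data.Product using (Σ; ∃; _×_; _,_)
open import Data.Sum using (_⊎_)
open import Data.List using (List; length)
open import Data.List.Relation.Unary.All using (All)
open import Data.List.Relation.Unary.AllPairs using (AllPairs)
open import Relation.Nullary using (¬_)
open import Relation.Binary.PropositionalEquality using (_≡_; _≢_)
open import Function.Definitions using (Injective)

-- Vertex labels inside a 5-cycle block; lowercase/uppercase letters are
-- both represented by this type (X corresponds to x).
data Letter : Set where
  a b c d e : Letter

nextL : Letter → Letter
nextL a = b
nextL b = c
nextL c = d
nextL d = e
nextL e = a

isA isC isB-D-E : Letter → Bool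
isA a = true
isA _ = false
isC c = true
isC _ = false
isB-D-E b = true
isB-D-E d = true
isB-D-E e = true
isB-D-E _ = false

-- leafOK m i x = true iff the leaf block L_{i,x} exists in G_m
-- (i = 0 : x ∈ {a,b,d,e};  1 ≤ i ≤ m-1 : x ∈ {b,d,e};  i = m : x ∈ {b,c,d,e}).
leafOK : ℕ → ℕ → Letter → Bool
leafOK m zero    x = not (isC x)
leafOK m (suc i) x = if suc i ≡ᵇ m then not (isA x) else isB-D-E x

data V (m : ℕ) : Set where
  spine : Fin (suc m) → Letter → V m
  leaf  : (i : Fin (suc m)) (x : Letter) → T (leafOK m (toℕ i) x) → Letter → V m
  hub   : V m   -- the vertex v

data Edge {m : ℕ} : V m → V m → Set where
  spineCyc : ∀ i x → Edge (spine i x) (spine i (nextL x))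
  leafCyc  : ∀ i x p X → Edge (leaf i x p X) (leaf i x p (nextL X))
  attach   : ∀ i x p → Edge (spine i x) (leaf i x p x)
  link     : ∀ i j → toℕ j ≡ suc (toℕ i) → Edge (spine i c) (spine j a)
  hubEdge  : ∀ i x p Y → Y ≢ x → Edge hub (leaf i x p Y)

Adj : ∀ {m} → V m → V m → Set
Adj u w = Edge u w ⊎ Edge w u

next : ∀ {n} → Fin (suc n) → Fin (suc n)
next {zero}  zero    = zero
next {suc n} zero    = suc zero
next {suc n} (suc i) with next {n} i
... | zero  = zero
... | suc j = suc (suc j)

record Cycle (m : ℕ) : Set where
  field
    k     : ℕ
    vert  : Fin (3 Data.Nat.+ k) → V m
    inj   : Injective _≡_ _≡_ vert
    adj   : ∀ j → Adj (vert j) (vert (next j))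

module _ {m : ℕ} (C : Cycle m) where
  open Cycle C

  OnC : V m → Set
  OnC u = ∃ λ j → vert j ≡ u

  Consecutive : V m → V m → Set
  Consecutive u w = ∃ λ j → (vert j ≡ u × vert (next j) ≡ w) ⊎ (vert j ≡ w × vert (next j) ≡ u)

  Chord : V m → V m → Set
  Chord u w = OnC u × OnC w × Adj u w × ¬ Consecutive u w

InLeaf : ∀ {m} (i : Fin (suc m)) (x : Letter) → T (leafOK m (toℕ i) x) → V m → Set
InLeaf i x p u = ∃ λ Y → u ≡ leaf i x p Y

CountedIn : ∀ {m} (i : Fin (suc m)) (x : Letter) → T (leafOK m (toℕ i) x) → V m → V m → Set
CountedIn i x p u w =
  (InLeaf i x p u × InLeaf i x p w) ⊎ ((u ≡ hub × InLeaf i x p w) ⊎ (w ≡ hub × InLeaf i x p u))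

SamePair : ∀ {m} → V m × V m → V m × V m → Set
SamePair (u , w) (u' , w') = (u ≡ u' × w ≡ w') ⊎ (u ≡ w' × w ≡ u')

module Submission where

-- Every vertex of a leaf block Q = L_{i,x} has degree 3 in G_m.  A vertex of Q lying on
-- C spends two of its three edges on its two neighbours along C, so it is an endpoint of
-- at most one chord of C.  Every chord counted in Q has an endpoint Q[Y] with Y ≠ X:
-- a spoke v–Q[Y] exists only for Y ≠ X, and a rim edge of Q has two distinct endpoints.
-- Choosing such an endpoint for each chord is therefore injective, and there are only
-- four letters Y ≠ X.

open import Defs
open import Data.Nat using (ℕ; zero; suc; _+_; _≤_; z≤n; s≤s)
open import Data.Nat.Properties using (≤-trans; ≤-refl; m≢1+n+m)
open import Data.Bool using (T; if_then_else_)
open import Data.Fin using (Fin; zero; suc; toℕ; fromℕ; inject₁)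
open import Data.Fin.Properties using () renaming (_≟_ to _≟ᶠ_)
open import Data.Product using (_×_; _,_; ∃; ∃₂; proj₁; proj₂)
open import Data.Sum using (_⊎_; inj₁; inj₂)
open import Data.Empty using (⊥-elim)
open import Data.List using (List; []; _∷_; length)
open import Data.List.Properties using (length-removeAt′)
open import Data.List.Relation.Unary.All as All using (All; []; _∷_)
open import Data.List.Relation.Unary.AllPairs using (AllPairs; []; _∷_)
open import Data.List.Relation.Unary.Any using (here; there; index; _─_)
open import Data.List.Membership.Propositional using (_∈_)
open import Relation.Nullary using (¬_; yes; no; does; contradiction)
open import Relation.Nullary.Decidable using (map′; dec-true; dec-false)
open import Relation.Binary.Definitions using (DecidableEquality)
open import Relation.Binary.PropositionalEquality
  using (_≡_; _≢_; refl; sym; trans; cong; subst; module ≡-Reasoning)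
open import Function using (_∘_)

prev : ∀ {n} → Fin (suc n) → Fin (suc n)
prev {n} zero    = fromℕ n
prev     (suc j) = inject₁ j

next-fromℕ : ∀ n → next (fromℕ n) ≡ zero
next-fromℕ zero = refl
next-fromℕ (suc n) rewrite next-fromℕ n = refl

next-inject₁ : ∀ {n} (j : Fin (suc n)) → next (inject₁ j) ≡ suc j
next-inject₁         zero    = refl
next-inject₁ {suc n} (suc j) rewrite next-inject₁ {n} j = refl

next-prev : ∀ {n} (j : Fin (suc n)) → next (prev j) ≡ j
next-prev {n}     zero    = next-fromℕ n
next-prev {suc n} (suc j) = next-inject₁ j

next-step-or-wrap : ∀ {n} (j : Fin (suc n)) →
                    toℕ (next j) ≡ suc (toℕ j) ⊎ (toℕ j ≡ n × next j ≡ zero)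
next-step-or-wrap {zero}  zero    = inj₂ (refl , refl)
next-step-or-wrap {suc n} zero    = inj₁ refl
next-step-or-wrap {suc n} (suc j) with next j | next-step-or-wrap j
... | zero  | inj₂ (j≡n , _) = inj₂ (cong suc j≡n , refl)
... | suc _ | inj₁ step      = inj₁ (cong suc step)

next∘next≢id : ∀ {k} (j : Fin (3 + k)) → next (next j) ≢ j
next∘next≢id {k} j next²j≡j with next-step-or-wrap j
... | inj₂ (j≡last , nextj≡0) = contradiction 1≡2+k λ ()
  where
  open ≡-Reasoning
  1≡2+k : 1 ≡ 2 + k
  1≡2+k = begin
    1                       ≡⟨⟩
    toℕ (next {2 + k} zero) ≡⟨ cong (toℕ ∘ next) nextj≡0 ⟨
    toℕ (next (next j))     ≡⟨ cong toℕ next²j≡j ⟩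
    toℕ j                   ≡⟨ j≡last ⟩
    2 + k                   ∎
... | inj₁ step with next-step-or-wrap (next j)
...   | inj₁ step′ = m≢1+n+m (toℕ j) {1} (begin
    toℕ j                   ≡⟨ cong toℕ next²j≡j ⟨
    toℕ (next (next j))     ≡⟨ step′ ⟩
    suc (toℕ (next j))      ≡⟨ cong suc step ⟩
    suc (suc (toℕ j))       ∎)
  where open ≡-Reasoning
...   | inj₂ (nextj≡last , next²j≡0) = contradiction 1≡2+k λ ()
  where
  open ≡-Reasoning
  1≡2+k : 1 ≡ 2 + k
  1≡2+k = begin
    1                       ≡⟨ cong (suc ∘ toℕ) (trans (sym next²j≡j) next²j≡0) ⟨
    suc (toℕ j)             ≡⟨ step ⟨
    toℕ (next j)            ≡⟨ nextj≡last ⟩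
    2 + k                   ∎

prevL : Letter → Letter
prevL a = e
prevL b = a
prevL c = b
prevL d = c
prevL e = d

prevL-nextL : ∀ X → prevL (nextL X) ≡ X
prevL-nextL a = refl
prevL-nextL b = refl
prevL-nextL c = refl
prevL-nextL d = refl
prevL-nextL e = refl

nextL≢id : ∀ X → nextL X ≢ X
nextL≢id a ()
nextL≢id b ()
nextL≢id c ()
nextL≢id d ()
nextL≢id e ()

allLetters : List Letter
allLetters = a ∷ b ∷ c ∷ d ∷ e ∷ []

∈-allLetters : ∀ X → X ∈ allLetters
∈-allLetters a = here refl
∈-allLetters b = there (here refl)
∈-allLetters c = there (there (here refl))
∈-allLetters d = there (there (there (here refl)))
∈-allLetters e = there (there (there (there (here refl))))

letterIndex : Letter → Fin 5
letterIndex a = zero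
letterIndex b = suc zero
letterIndex c = suc (suc zero)
letterIndex d = suc (suc (suc zero))
letterIndex e = suc (suc (suc (suc zero)))

letterAt : Fin 5 → Letter
letterAt zero                            = a
letterAt (suc zero)                      = b
letterAt (suc (suc zero))                = c
letterAt (suc (suc (suc zero)))          = d
letterAt (suc (suc (suc (suc zero))))    = e

letterAt-letterIndex : ∀ X → letterAt (letterIndex X) ≡ X
letterAt-letterIndex a = refl
letterAt-letterIndex b = refl
letterAt-letterIndex c = refl
letterAt-letterIndex d = refl
letterAt-letterIndex e = refl

_≟ᴸ_ : DecidableEquality Letter
X ≟ᴸ Y = map′ index-injective (cong letterIndex) (letterIndex X ≟ᶠ letterIndex Y)
  where
  index-injective : letterIndex X ≡ letterIndex Y → X ≡ Y
  index-injective eq =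
    trans (sym (letterAt-letterIndex X)) (trans (cong letterAt eq) (letterAt-letterIndex Y))

module _ {A : Set} where

  ∈-─ : ∀ {y z : A} {ys} (y∈ys : y ∈ ys) → z ∈ ys → z ≢ y → z ∈ (ys ─ y∈ys)
  ∈-─ (here refl)  (here refl)  z≢y = ⊥-elim (z≢y refl)
  ∈-─ (here _)     (there z∈ys) _   = z∈ys
  ∈-─ (there _)    (here z≡y′)  _   = here z≡y′
  ∈-─ (there y∈ys) (there z∈ys) z≢y = there (∈-─ y∈ys z∈ys z≢y)

  distinct⊆⇒length≤ : ∀ {xs ys : List A} → AllPairs _≢_ xs → All (_∈ ys) xs → length xs ≤ length ys
  distinct⊆⇒length≤ {[]}     _ _ = z≤n
  distinct⊆⇒length≤ {x ∷ xs} {ys} (x≢xs ∷ distinct) (x∈ys ∷ xs⊆ys)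
    rewrite length-removeAt′ ys (index x∈ys) = s≤s (distinct⊆⇒length≤ distinct xs⊆ys─x)
    where
    xs⊆ys─x : All (_∈ (ys ─ x∈ys)) xs
    xs⊆ys─x = All.zipWith (λ (z∈ys , x≢z) → ∈-─ x∈ys z∈ys (x≢z ∘ sym)) (xs⊆ys , x≢xs)

module _ {A B : Set} {P : A → Set} (f : ∀ {x} → P x → B) where

  length-reduce : ∀ {xs} (pxs : All P xs) → length (All.reduce f pxs) ≡ length xs
  length-reduce []         = refl
  length-reduce (_ ∷ pxs)  = cong suc (length-reduce pxs)

  All-reduce : ∀ {Q : B → Set} {xs} → (∀ {x} (px : P x) → Q (f px)) → (pxs : All P xs) →
               All Q (All.reduce f pxs)
  All-reduce q []         = []
  All-reduce q (px ∷ pxs) = q px ∷ All-reduce q pxs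

  AllPairs-reduce : ∀ {R : A → A → Set} {S : B → B → Set} {xs} →
                    (∀ {x y} (px : P x) (py : P y) → R x y → S (f px) (f py)) →
                    (pxs : All P xs) → AllPairs R xs → AllPairs S (All.reduce f pxs)
  AllPairs-reduce r [] [] = []
  AllPairs-reduce {R = R} {S} r (px ∷ pxs) (Rx ∷ Rxs) = related pxs Rx ∷ AllPairs-reduce r pxs Rxs
    where
    related : ∀ {x ys} {px : P x} (pys : All P ys) → All (R x) ys → All (S (f px)) (All.reduce f pys)
    related []         []         = []
    related (py ∷ pys) (Rxy ∷ Rxs′) = r _ py Rxy ∷ related pys Rxs′

module _ {m : ℕ} where

  Adj-sym : {u w : V m} → Adj u w → Adj w u
  Adj-sym (inj₁ uw) = inj₂ uw
  Adj-sym (inj₂ wu) = inj₁ wu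

  module _ (C : Cycle m) where
    open Cycle C

    Consecutive-sym : ∀ {u w} → Consecutive C u w → Consecutive C w u
    Consecutive-sym (j , inj₁ uw) = j , inj₂ uw
    Consecutive-sym (j , inj₂ wu) = j , inj₁ wu

    Consecutive⇒Adj : ∀ {u w} → Consecutive C u w → Adj u w
    Consecutive⇒Adj (j , inj₁ (refl , refl)) = adj j
    Consecutive⇒Adj (j , inj₂ (refl , refl)) = Adj-sym (adj j)

    Chord-sym : ∀ {u w} → Chord C u w → Chord C w u
    Chord-sym (u∈C , w∈C , uw , ¬cons) = w∈C , u∈C , Adj-sym uw , ¬cons ∘ Consecutive-sym

    two-consecutive : ∀ {u} → OnC C u →
                      ∃₂ λ w₁ w₂ → Consecutive C u w₁ × Consecutive C u w₂ × w₁ ≢ w₂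
    two-consecutive (j , refl) =
      vert (next j) , vert (prev j) , (j , inj₁ (refl , refl)) ,
      (prev j , inj₂ (refl , cong vert (next-prev j))) ,
      λ eq → next∘next≢id (prev j) (trans (cong next (next-prev j)) (inj eq))

    at-most-one-chord : ∀ {u w₁ w₂} (ns : List (V m)) → length ns ≤ 3 →
                        (∀ {w} → Adj u w → w ∈ ns) →
                        Chord C u w₁ → Chord C u w₂ → ¬ w₁ ≢ w₂
    at-most-one-chord {u} {w₁} {w₂} ns ns≤3 nbrs⊆ns
                      (u∈C , _ , uw₁ , ¬cons₁) (_ , _ , uw₂ , ¬cons₂) w₁≢w₂
      with two-consecutive u∈C
    ... | n₁ , n₂ , cons₁ , cons₂ , n₁≢n₂ = 4≰3 (≤-trans (distinct⊆⇒length≤ distinct ⊆ns) ns≤3)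
      where
      4≰3 : ¬ 4 ≤ 3
      4≰3 (s≤s (s≤s (s≤s ())))
      apart : ∀ {n w} → Consecutive C u n → ¬ Consecutive C u w → n ≢ w
      apart cons ¬cons refl = ¬cons cons
      distinct : AllPairs _≢_ (n₁ ∷ n₂ ∷ w₁ ∷ w₂ ∷ [])
      distinct = (n₁≢n₂ ∷ apart cons₁ ¬cons₁ ∷ apart cons₁ ¬cons₂ ∷ [])
               ∷ (apart cons₂ ¬cons₁ ∷ apart cons₂ ¬cons₂ ∷ [])
               ∷ (w₁≢w₂ ∷ [])
               ∷ [] ∷ []
      ⊆ns : All (_∈ ns) (n₁ ∷ n₂ ∷ w₁ ∷ w₂ ∷ [])
      ⊆ns = nbrs⊆ns (Consecutive⇒Adj cons₁) ∷ nbrs⊆ns (Consecutive⇒Adj cons₂)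
          ∷ nbrs⊆ns uw₁ ∷ nbrs⊆ns uw₂ ∷ []

  data Endpoint (u : V m) : V m × V m → Set where
    first  : ∀ w → Endpoint u (u , w)
    second : ∀ w → Endpoint u (w , u)

  partner : ∀ {u uw} → Endpoint u uw → V m
  partner (first w)  = w
  partner (second w) = w

  Endpoint-chord : ∀ C {u uw} (ε : Endpoint u uw) →
                   Chord C (proj₁ uw) (proj₂ uw) → Chord C u (partner ε)
  Endpoint-chord C (first _)  chord = chord
  Endpoint-chord C (second _) chord = Chord-sym C chord

  Endpoint-SamePair : ∀ {u q r} (ε : Endpoint u q) (ε′ : Endpoint u r) →
                      partner ε ≡ partner ε′ → SamePair q r
  Endpoint-SamePair (first _)  (first _)  refl = inj₁ (refl , refl)
  Endpoint-SamePair (first _)  (second _) refl = inj₂ (refl , refl)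
  Endpoint-SamePair (second _) (first _)  refl = inj₂ (refl , refl)
  Endpoint-SamePair (second _) (second _) refl = inj₁ (refl , refl)

  chords-at-common-endpoint : ∀ (C : Cycle m) {u q r} (ns : List (V m)) → length ns ≤ 3 →
                              (∀ {w} → Adj u w → w ∈ ns) → Endpoint u q → Endpoint u r →
                              Chord C (proj₁ q) (proj₂ q) → Chord C (proj₁ r) (proj₂ r) → ¬ ¬ SamePair q r
  chords-at-common-endpoint C ns ns≤3 nbrs⊆ns ε ε′ chord chord′ ¬same =
    at-most-one-chord C ns ns≤3 nbrs⊆ns (Endpoint-chord C ε chord) (Endpoint-chord C ε′ chord′)
      (λ eq → ¬same (Endpoint-SamePair ε ε′ eq))

module LeafBlock {m : ℕ} (i : Fin (suc m)) (x : Letter) (p : T (leafOK m (toℕ i) x)) where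

  stalk : Letter → V m
  stalk Y = if does (Y ≟ᴸ x) then spine i x else hub

  leafNeighbours : Letter → List (V m)
  leafNeighbours Y = leaf i x p (nextL Y) ∷ leaf i x p (prevL Y) ∷ stalk Y ∷ []

  leafNeighbours-complete : ∀ {Y w} → Adj (leaf i x p Y) w → w ∈ leafNeighbours Y
  leafNeighbours-complete (inj₁ (leafCyc _ _ _ _)) = here refl
  leafNeighbours-complete (inj₂ (leafCyc _ _ _ X)) = there (here (cong (leaf i x p) (sym (prevL-nextL X))))
  leafNeighbours-complete (inj₂ (attach _ _ _))
    rewrite dec-true (x ≟ᴸ x) refl = there (there (here refl))
  leafNeighbours-complete (inj₂ (hubEdge _ _ _ Y Y≢x))
    rewrite dec-false (Y ≟ᴸ x) Y≢x = there (there (here refl))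

  leaf-adj-leaf⇒≢ : ∀ {Y Z} → Adj (leaf i x p Y) (leaf i x p Z) → Y ≢ Z
  leaf-adj-leaf⇒≢ (inj₁ (leafCyc _ _ _ Y)) Y≡nextY = nextL≢id Y (sym Y≡nextY)
  leaf-adj-leaf⇒≢ (inj₂ (leafCyc _ _ _ Z)) nextZ≡Z = nextL≢id Z nextZ≡Z

  hub-adj-leaf⇒≢ : ∀ {Y} → Adj hub (leaf i x p Y) → Y ≢ x
  hub-adj-leaf⇒≢ (inj₁ (hubEdge _ _ _ _ Y≢x)) = Y≢x

  record Anchor (uw : V m × V m) : Set where
    constructor anchored
    field
      letter   : Letter
      ≢x       : letter ≢ x
      endpoint : Endpoint (leaf i x p letter) uw

  anchor : ∀ {u w} → Adj u w → CountedIn i x p u w → Anchor (u , w)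
  anchor uw (inj₁ ((Y , refl) , (Z , refl))) with Y ≟ᴸ x
  ... | no Y≢x   = anchored Y Y≢x (first _)
  ... | yes refl = anchored Z (λ Z≡x → leaf-adj-leaf⇒≢ uw (sym Z≡x)) (second _)
  anchor uw (inj₂ (inj₁ (refl , (Y , refl)))) = anchored Y (hub-adj-leaf⇒≢ uw) (second _)
  anchor uw (inj₂ (inj₂ (refl , (Y , refl)))) = anchored Y (hub-adj-leaf⇒≢ (Adj-sym uw)) (first _)

  anchors-differ : ∀ (C : Cycle m) {q r} (α : Anchor q) (β : Anchor r) →
                   Chord C (proj₁ q) (proj₂ q) → Chord C (proj₁ r) (proj₂ r) →
                   ¬ SamePair q r → Anchor.letter α ≢ Anchor.letter β
  anchors-differ C (anchored Y _ ε) (anchored _ _ ε′) chord chord′ ¬same refl =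
    chords-at-common-endpoint C (leafNeighbours Y) ≤-refl leafNeighbours-complete
                              ε ε′ chord chord′ ¬same

  ≢x-distinct⇒length≤4 : ∀ {Ys : List Letter} → AllPairs _≢_ Ys → All (_≢ x) Ys → length Ys ≤ 4
  ≢x-distinct⇒length≤4 distinct ≢x
    with distinct⊆⇒length≤ (All.map (_∘ sym) ≢x ∷ distinct)
                           (All.tabulate (λ {Y} _ → ∈-allLetters Y))
  ... | s≤s length≤4 = length≤4

  CountedChord : Cycle m → V m × V m → Set
  CountedChord C uw = Chord C (proj₁ uw) (proj₂ uw) × CountedIn i x p (proj₁ uw) (proj₂ uw)

  anchorOf : ∀ C {uw} → CountedChord C uw → Anchor uw
  anchorOf C ((_ , _ , uw , _) , counts) = anchor uw counts

  letterOf : ∀ C {uw} → CountedChord C uw → Letter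
  letterOf C counted = Anchor.letter (anchorOf C counted)

lemma4p8 : (m : ℕ) → 1 ≤ m → (C : Cycle m) → OnC C hub →
    (i : Fin (suc m)) (x : Letter) (p : T (leafOK m (toℕ i) x)) →
    (∃ λ Y → OnC C (leaf i x p Y)) →
    (cs : List (V m × V m)) →
    All (λ uw → Chord C (proj₁ uw) (proj₂ uw) × CountedIn i x p (proj₁ uw) (proj₂ uw)) cs →
    AllPairs (λ q r → ¬ SamePair q r) cs →
    length cs ≤ 4
lemma4p8 m _ C _ i x p _ cs counted distinct =
  subst (_≤ 4) (length-reduce (letterOf C) counted) (≢x-distinct⇒length≤4 letters-distinct letters-≢x)
  where
  open LeafBlock i x p
  letters-distinct : AllPairs _≢_ (All.reduce (letterOf C) counted)
  letters-distinct = AllPairs-reduce (letterOf C)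
    (λ cq cr → anchors-differ C (anchorOf C cq) (anchorOf C cr) (proj₁ cq) (proj₁ cr)) counted distinct
  letters-≢x : All (_≢ x) (All.reduce (letterOf C) counted)
  letters-≢x = All-reduce (letterOf C) (Anchor.≢x ∘ anchorOf C) counted
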